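{- $WT$ is interpretable in $WQT$ ($WT\le_I WQT$).
   Context: $WT$ is the first-order theory in the language $\mathcal{L}_T=\{0,(\cdot,\cdot),\sqsubseteq\}$ (constant $0$, binary function symbol $(x,y)$, binary relation $\sqsubseteq$) with axiom schemas: (WT1) $\neg(s=t)$ for any distinct variable-free $\mathcal{L}_T$-terms $s,t$; (WT2) $\forall x\,(x\sqsubseteq t\leftrightarrow\bigvee_{s\in S(t)}x=s)$ for each variable-free $\mathcal{L}_T$-term $t$, where $S(t)$ is the set of subterms of $t$. $WQT$ is the first-order theory in the language $\{a,b,*,\sqsubseteq^*\}$ ($a,b$ constants, $*$ binary function, $\sqsubseteq^*$ binary relation). To each variable-free $\mathcal{L}_T$-term $v$ associate the term $v^\tau$ of this language by $0^\tau\equiv a$, $(u,v)^\tau\equiv b*(u^\tau*v^\tau)$; let $\Sigma^\tau$ be the set of all terms $v^\tau$ for $v$ a variable-free $\mathcal{L}_T$-term. The axioms of $WQT$ are: (WQT1) $\neg(s=t)$ for any distinct terms $s,t\in\Sigma^\tau$; (WQT2) $\forall z\,(z\sqsubseteq^* b*(s*t)\leftrightarrow z=b*(s*t)\vee z\sqsubseteq^* s\vee z\sqsubseteq^* t)$ for all $s,t\in\Sigma^\tau$; (WQT3) $\forall z\,(z\sqsubseteq^* a\leftrightarrow z=a)$. Interpretability is the usual relative interpretability of first-order theories. -}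

module Defs where

open import Data.Nat using (ℕ; zero; suc; _+_)
open import Data.Fin using (Fin; zero; suc; _↑ˡ_; _↑ʳ_)
open import Data.Vec using (Vec; []; _∷_; tabulate; lookup)
open import Data.List using (List; []; _∷_; _++_; [_]; foldr)
import Data.List as List
open import Data.List.Membership.Propositional using (_∈_)
open import Relation.Binary.PropositionalEquality using (_≢_)

record Signature : Set₁ where
  field
    Func   : Set
    fArity : Func → ℕ
    Rel    : Set
    rArity : Rel → ℕ
open Signature public

-- Well-scoped terms and formulas (de Bruijn indices; n = number of
-- free variables in scope, variable `zero` is the innermost one)

data Term (L : Signature) (n : ℕ) : Set where
  var : Fin n → Term L n
  fn  : (f : Func L) → Vec (Term L n) (fArity L f) → Term L n

infixr 6 _⇒_
infix  8 _≐_

data Formula (L : Signature) : ℕ → Set where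
  ⊥'  : ∀ {n} → Formula L n
  rel : ∀ {n} (R : Rel L) → Vec (Term L n) (rArity L R) → Formula L n
  _≐_ : ∀ {n} → Term L n → Term L n → Formula L n
  _⇒_ : ∀ {n} → Formula L n → Formula L n → Formula L n
  ∀'  : ∀ {n} → Formula L (suc n) → Formula L n

module _ {L : Signature} where

  infixr 7 _∧'_ _∨'_
  infix 6 _⇔'_

  ¬' : ∀ {n} → Formula L n → Formula L n
  ¬' φ = φ ⇒ ⊥'

  ⊤' : ∀ {n} → Formula L n
  ⊤' = ¬' ⊥'

  _∧'_ : ∀ {n} → Formula L n → Formula L n → Formula L n
  φ ∧' ψ = ¬' (φ ⇒ ¬' ψ)

  _∨'_ : ∀ {n} → Formula L n → Formula L n → Formula L n
  φ ∨' ψ = ¬' φ ⇒ ψ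

  _⇔'_ : ∀ {n} → Formula L n → Formula L n → Formula L n
  φ ⇔' ψ = (φ ⇒ ψ) ∧' (ψ ⇒ φ)

  ∃' : ∀ {n} → Formula L (suc n) → Formula L n
  ∃' φ = ¬' (∀' (¬' φ))

  ⋀ : ∀ {n} → List (Formula L n) → Formula L n
  ⋀ = foldr _∧'_ ⊤'

  ⋁ : ∀ {n} → List (Formula L n) → Formula L n
  ⋁ = foldr _∨'_ ⊥'

  ⋀V : ∀ {n k} → Vec (Formula L n) k → Formula L n
  ⋀V []       = ⊤'
  ⋀V (φ ∷ φs) = φ ∧' ⋀V φs

  ∃ⁿ : ∀ k {m} → Formula L (k + m) → Formula L m
  ∃ⁿ zero    φ = φ
  ∃ⁿ (suc k) φ = ∃ⁿ k (∃' φ)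

  ∀ᶜ : ∀ k → Formula L k → Formula L 0
  ∀ᶜ zero    φ = φ
  ∀ᶜ (suc k) φ = ∀ᶜ k (∀' φ)

  liftR : ∀ {m k} → (Fin m → Fin k) → Fin (suc m) → Fin (suc k)
  liftR ρ zero    = zero
  liftR ρ (suc i) = suc (ρ i)

  mutual
    renT : ∀ {m k} → (Fin m → Fin k) → Term L m → Term L k
    renT ρ (var i)   = var (ρ i)
    renT ρ (fn f ts) = fn f (renTs ρ ts)

    renTs : ∀ {m k j} → (Fin m → Fin k) → Vec (Term L m) j → Vec (Term L k) j
    renTs ρ []       = []
    renTs ρ (t ∷ ts) = renT ρ t ∷ renTs ρ ts

  ren : ∀ {m k} → (Fin m → Fin k) → Formula L m → Formula L k
  ren ρ ⊥'         = ⊥'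
  ren ρ (rel R ts) = rel R (renTs ρ ts)
  ren ρ (s ≐ t)    = renT ρ s ≐ renT ρ t
  ren ρ (φ ⇒ ψ)    = ren ρ φ ⇒ ren ρ ψ
  ren ρ (∀' φ)     = ∀' (ren (liftR ρ) φ)

  liftS : ∀ {m k} → (Fin m → Term L k) → Fin (suc m) → Term L (suc k)
  liftS σ zero    = var zero
  liftS σ (suc i) = renT suc (σ i)

  mutual
    subT : ∀ {m k} → (Fin m → Term L k) → Term L m → Term L k
    subT σ (var i)   = σ i
    subT σ (fn f ts) = fn f (subTs σ ts)

    subTs : ∀ {m k j} → (Fin m → Term L k) → Vec (Term L m) j → Vec (Term L k) j
    subTs σ []       = []
    subTs σ (t ∷ ts) = subT σ t ∷ subTs σ ts

  sub : ∀ {m k} → (Fin m → Term L k) → Formula L m → Formula L k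
  sub σ ⊥'         = ⊥'
  sub σ (rel R ts) = rel R (subTs σ ts)
  sub σ (s ≐ t)    = subT σ s ≐ subT σ t
  sub σ (φ ⇒ ψ)    = sub σ φ ⇒ sub σ ψ
  sub σ (∀' φ)     = ∀' (sub (liftS σ) φ)

  _⟦_⟧ : ∀ {n} → Formula L (suc n) → Term L n → Formula L n
  φ ⟦ t ⟧ = sub σ φ
    where
      σ : Fin (suc _) → Term L _
      σ zero    = t
      σ (suc i) = var i

  wkSent : ∀ {n} → Formula L 0 → Formula L n
  wkSent = ren (λ ())

  wkClosed : ∀ {n} → Term L 0 → Term L n
  wkClosed = renT (λ ())

Theory : Signature → Set₁
Theory L = Formula L 0 → Set

infix 3 Pf

data Pf {L : Signature} (T : Theory L) : ∀ {n} → List (Formula L n) → Formula L n → Set where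
  hyp    : ∀ {n} {Γ : List (Formula L n)} {φ} → φ ∈ Γ → Pf T Γ φ
  ax     : ∀ {n} {Γ : List (Formula L n)} {φ} → T φ → Pf T Γ (wkSent φ)
  ⇒I     : ∀ {n} {Γ : List (Formula L n)} {φ ψ} → Pf T (φ ∷ Γ) ψ → Pf T Γ (φ ⇒ ψ)
  ⇒E     : ∀ {n} {Γ : List (Formula L n)} {φ ψ} → Pf T Γ (φ ⇒ ψ) → Pf T Γ φ → Pf T Γ ψ
  raa    : ∀ {n} {Γ : List (Formula L n)} {φ} → Pf T (¬' φ ∷ Γ) ⊥' → Pf T Γ φ
  ∀I     : ∀ {n} {Γ : List (Formula L n)} {φ} → Pf T (List.map (ren suc) Γ) φ → Pf T Γ (∀' φ)
  ∀E     : ∀ {n} {Γ : List (Formula L n)} {φ} → Pf T Γ (∀' φ) → (t : Term L n) → Pf T Γ (φ ⟦ t ⟧)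
  ≐refl  : ∀ {n} {Γ : List (Formula L n)} (t : Term L n) → Pf T Γ (t ≐ t)
  ≐subst : ∀ {n} {Γ : List (Formula L n)} {s t : Term L n} (φ : Formula L (suc n))
           → Pf T Γ (s ≐ t) → Pf T Γ (φ ⟦ s ⟧) → Pf T Γ (φ ⟦ t ⟧)

_⊢_ : ∀ {L} → Theory L → Formula L 0 → Set
T ⊢ φ = Pf T [] φ

-- Relative interpretations (Tarski–Mostowski–Robinson style):
-- a domain formula δ(x), for each n-ary function symbol f a formula
-- φ_f(x₁..xₙ,y) and for each n-ary relation symbol R a formula
-- φ_R(x₁..xₙ); equality is translated as equality.
--
-- Conventions for free variables:
--   δ      : Formula L₂ 1,             var zero = x
--   φ_f    : Formula L₂ (suc n),       var zero = y (output), var (suc i) = xᵢ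
--   φ_R    : Formula L₂ n,             var i = xᵢ

record Translation (L₁ L₂ : Signature) : Set where
  field
    δ    : Formula L₂ 1
    funF : (f : Func L₁) → Formula L₂ (suc (fArity L₁ f))
    relF : (R : Rel L₁) → Formula L₂ (rArity L₁ R)

module Translate {L₁ L₂ : Signature} (τ : Translation L₁ L₂) where
  open Translation τ

  δat : ∀ {n} → Fin n → Formula L₂ n
  δat i = ren (λ _ → i) δ

  -- atom φs ψ: ∃z₁..z_k (⋀ δ(zᵢ) ∧ ⋀ φᵢ(zᵢ) ∧ ψ), where each φᵢ has
  -- var zero = its "output" zᵢ and the remaining variables = context m
  atom : ∀ {m k} → Vec (Formula L₂ (suc m)) k → Formula L₂ (k + m) → Formula L₂ m
  atom {m} {k} φs ψ =
    ∃ⁿ k (⋀V (tabulate (λ i → δat (i ↑ˡ m)))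
          ∧' ⋀V (tabulate (λ i → ren (σ i) (lookup φs i)))
          ∧' ψ)
    where
      σ : Fin k → Fin (suc m) → Fin (k + m)
      σ i zero    = i ↑ˡ m
      σ i (suc j) = k ↑ʳ j

  skip1 : ∀ {n} → Fin (suc n) → Fin (suc (suc n))
  skip1 zero    = zero
  skip1 (suc j) = suc (suc j)

  -- trT t : "var zero is the value of t"; other variables = those of t
  mutual
    trT : ∀ {n} → Term L₁ n → Formula L₂ (suc n)
    trT (var i)           = var zero ≐ var (suc i)
    trT {n} (fn f ts)     =
      atom {suc n} {fArity L₁ f} (renFs (trTs ts)) (ren ρ (funF f))
      where
        ρ : Fin (suc (fArity L₁ f)) → Fin (fArity L₁ f + suc n)
        ρ zero    = fArity L₁ f ↑ʳ zero
        ρ (suc i) = i ↑ˡ suc n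
        renFs : ∀ {k} → Vec (Formula L₂ (suc n)) k → Vec (Formula L₂ (suc (suc n))) k
        renFs []       = []
        renFs (φ ∷ φs) = ren skip1 φ ∷ renFs φs

    trTs : ∀ {n k} → Vec (Term L₁ n) k → Vec (Formula L₂ (suc n)) k
    trTs []       = []
    trTs (t ∷ ts) = trT t ∷ trTs ts

  tr : ∀ {n} → Formula L₁ n → Formula L₂ n
  tr ⊥'             = ⊥'
  tr {n} (rel R ts) = atom (trTs ts) (ren (_↑ˡ n) (relF R))
  tr {n} (s ≐ t)    = atom (trT s ∷ trT t ∷ []) (var (zero ↑ˡ n) ≐ var (suc zero ↑ˡ n))
  tr (φ ⇒ ψ)        = tr φ ⇒ tr ψ
  tr (∀' φ)         = ∀' (δat zero ⇒ tr φ)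

  totality : (f : Func L₁) → Formula L₂ 0
  totality f = ∀ᶜ k (⋀V (tabulate δat) ⇒ ∃' (δat zero ∧' funF f))
    where k = fArity L₁ f

  -- ∀x̄ ∀y ∀y' (⋀ δ(xᵢ) ∧ δ(y) ∧ δ(y') ∧ φ_f(x̄,y) ∧ φ_f(x̄,y') → y = y')
  -- (context: var zero = y', var (suc zero) = y, var (suc (suc i)) = xᵢ)
  uniqueness : (f : Func L₁) → Formula L₂ 0
  uniqueness f =
    ∀ᶜ (suc (suc k))
      ((⋀V (tabulate (λ i → δat (suc (suc i))))
        ∧' δat (suc zero) ∧' δat zero
        ∧' ren ρ₁ (funF f) ∧' ren ρ₂ (funF f))
       ⇒ (var (suc zero) ≐ var zero))
    where
      k = fArity L₁ f
      ρ₁ : Fin (suc k) → Fin (suc (suc k))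
      ρ₁ zero    = suc zero
      ρ₁ (suc i) = suc (suc i)
      ρ₂ : Fin (suc k) → Fin (suc (suc k))
      ρ₂ zero    = zero
      ρ₂ (suc i) = suc (suc i)

record Interpretation {L₁ L₂ : Signature} (T : Theory L₁) (S : Theory L₂) : Set where
  field
    τ : Translation L₁ L₂
  open Translation τ public
  open Translate τ public
  field
    domNonempty : S ⊢ ∃' δ
    funTotal    : (f : Func L₁) → S ⊢ totality f
    funUnique   : (f : Func L₁) → S ⊢ uniqueness f
    axioms      : (φ : Formula L₁ 0) → T φ → S ⊢ tr φ

infix 4 _≤I_
_≤I_ : ∀ {L₁ L₂} → Theory L₁ → Theory L₂ → Set
T ≤I S = Interpretation T S

data FuncT : Set where
  zeroF pairF : FuncT

data RelT : Set where
  ⊑R : RelT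

arityFT : FuncT → ℕ
arityFT zeroF = 0
arityFT pairF = 2

LT : Signature
LT = record { Func = FuncT ; fArity = arityFT ; Rel = RelT ; rArity = λ _ → 2 }

subtermsT : Term LT 0 → List (Term LT 0)
subtermsT (var ())
subtermsT (fn zeroF [])               = [ fn zeroF [] ]
subtermsT (fn pairF (u ∷ v ∷ []))     =
  fn pairF (u ∷ v ∷ []) ∷ (subtermsT u ++ subtermsT v)

_⊑_ : ∀ {n} → Term LT n → Term LT n → Formula LT n
s ⊑ t = rel ⊑R (s ∷ t ∷ [])

x₀ : ∀ {L n} → Term L (suc n)
x₀ = var zero

data WT : Theory LT where
  WT1 : (s t : Term LT 0) → s ≢ t → WT (¬' (s ≐ t))
  WT2 : (t : Term LT 0) →
        WT (∀' ((x₀ ⊑ wkClosed t) ⇔' ⋁ (List.map (λ s → x₀ ≐ wkClosed s) (subtermsT t))))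

data FuncQ : Set where
  aF bF starF : FuncQ

data RelQ : Set where
  ⊑*R : RelQ

arityFQ : FuncQ → ℕ
arityFQ aF    = 0
arityFQ bF    = 0
arityFQ starF = 2

LQT : Signature
LQT = record { Func = FuncQ ; fArity = arityFQ ; Rel = RelQ ; rArity = λ _ → 2 }

aQ bQ : ∀ {n} → Term LQT n
aQ = fn aF []
bQ = fn bF []

infixr 9 _*_
_*_ : ∀ {n} → Term LQT n → Term LQT n → Term LQT n
s * t = fn starF (s ∷ t ∷ [])

_⊑*_ : ∀ {n} → Term LQT n → Term LQT n → Formula LQT n
s ⊑* t = rel ⊑*R (s ∷ t ∷ [])

-- the map v ↦ v^τ ; Σ^τ is its image
_^τ : Term LT 0 → Term LQT 0
var () ^τ
fn zeroF [] ^τ             = aQ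
fn pairF (u ∷ v ∷ []) ^τ   = bQ * ((u ^τ) * (v ^τ))

data WQT : Theory LQT where
  -- distinct s = u^τ, t = v^τ in Σ^τ
  WQT1 : (u v : Term LT 0) → (u ^τ) ≢ (v ^τ) → WQT (¬' ((u ^τ) ≐ (v ^τ)))
  WQT2 : (u v : Term LT 0) →
         let s = wkClosed (u ^τ) ; t = wkClosed (v ^τ) in
         WQT (∀' ((x₀ ⊑* (bQ * (s * t))) ⇔'
                  ((x₀ ≐ bQ * (s * t)) ∨' ((x₀ ⊑* s) ∨' (x₀ ⊑* t)))))
  WQT3 : WQT (∀' ((x₀ ⊑* aQ) ⇔' (x₀ ≐ aQ)))

-- Interpret every L_T-symbol by its image under v ↦ v^τ: 0 by a, (x,y) by b*(x*y), ⊑ by ⊑*,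
-- on the whole domain.  The translation of a variable-free term t then provably denotes t^τ,
-- so WT1 becomes an instance of WQT1 (v ↦ v^τ is injective) and WT2 for t becomes the
-- statement that the ⊑*-predecessors of t^τ are exactly the s^τ with s a subterm of t,
-- which follows from WQT2 and WQT3 by induction on t.

module Submission where

open import Defs
open import Data.Nat using (ℕ; zero; suc)
open import Data.Fin using (Fin; zero; suc; _↑ˡ_)
open import Data.Vec using (Vec; []; _∷_)
open import Data.Vec.Functional using () renaming (_∷_ to _∷ˢ_)
open import Data.List using (List; []; _∷_; _++_; map)
open import Data.List.Properties using (map-++)
open import Data.List.Relation.Binary.Subset.Propositional using (_⊆_)
open import Data.List.Relation.Binary.Subset.Propositional.Properties using (map⁺; ∷⁺ʳ; xs⊆x∷xs)
open import Data.List.Relation.Unary.Any using (here; there)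
open import Data.Product using (_×_; _,_)
open import Function using (_∘_)
open import Relation.Binary.Bundles using (Setoid)
open import Relation.Binary.PropositionalEquality
import Relation.Binary.Reasoning.Setoid as SetoidReasoning

module _ {L : Signature} where

  mutual
    subT-cong : ∀ {m k} {σ σ' : Fin m → Term L k} → σ ≗ σ' → (t : Term L m) → subT σ t ≡ subT σ' t
    subT-cong e (var i)   = e i
    subT-cong e (fn f ts) = cong (fn f) (subTs-cong e ts)

    subTs-cong : ∀ {m k j} {σ σ' : Fin m → Term L k} → σ ≗ σ' →
                 (ts : Vec (Term L m) j) → subTs σ ts ≡ subTs σ' ts
    subTs-cong e []       = refl
    subTs-cong e (t ∷ ts) = cong₂ _∷_ (subT-cong e t) (subTs-cong e ts)

  mutual
    subT-subT : ∀ {m k j} {σ : Fin k → Term L j} {τ : Fin m → Term L k} (t : Term L m) →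
                subT σ (subT τ t) ≡ subT (subT σ ∘ τ) t
    subT-subT (var i)   = refl
    subT-subT (fn f ts) = cong (fn f) (subTs-subTs ts)

    subTs-subTs : ∀ {m k j l} {σ : Fin k → Term L j} {τ : Fin m → Term L k} (ts : Vec (Term L m) l) →
                  subTs σ (subTs τ ts) ≡ subTs (subT σ ∘ τ) ts
    subTs-subTs []       = refl
    subTs-subTs (t ∷ ts) = cong₂ _∷_ (subT-subT t) (subTs-subTs ts)

  mutual
    renT≡subT : ∀ {m k} {ρ : Fin m → Fin k} (t : Term L m) → renT ρ t ≡ subT (var ∘ ρ) t
    renT≡subT (var i)   = refl
    renT≡subT (fn f ts) = cong (fn f) (renTs≡subTs ts)

    renTs≡subTs : ∀ {m k l} {ρ : Fin m → Fin k} (ts : Vec (Term L m) l) → renTs ρ ts ≡ subTs (var ∘ ρ) ts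
    renTs≡subTs []       = refl
    renTs≡subTs (t ∷ ts) = cong₂ _∷_ (renT≡subT t) (renTs≡subTs ts)

  mutual
    subT-var : ∀ {m} (t : Term L m) → subT var t ≡ t
    subT-var (var i)   = refl
    subT-var (fn f ts) = cong (fn f) (subTs-var ts)

    subTs-var : ∀ {m l} (ts : Vec (Term L m) l) → subTs var ts ≡ ts
    subTs-var []       = refl
    subTs-var (t ∷ ts) = cong₂ _∷_ (subT-var t) (subTs-var ts)

  subT-renT : ∀ {m k j} {σ : Fin k → Term L j} {ρ : Fin m → Fin k} (t : Term L m) →
              subT σ (renT ρ t) ≡ subT (σ ∘ ρ) t
  subT-renT {σ = σ} t = trans (cong (subT σ) (renT≡subT t)) (subT-subT t)

  renT-subT : ∀ {m k j} {ρ : Fin k → Fin j} {σ : Fin m → Term L k} (t : Term L m) →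
              renT ρ (subT σ t) ≡ subT (renT ρ ∘ σ) t
  renT-subT {σ = σ} t =
    trans (renT≡subT (subT σ t)) (trans (subT-subT t) (subT-cong (sym ∘ renT≡subT ∘ σ) t))

  subT-closed : ∀ {n} (σ : Fin 0 → Term L n) (c : Term L 0) → subT σ c ≡ wkClosed c
  subT-closed σ c = trans (subT-cong (λ ()) c) (sym (renT≡subT c))

  renT-closed : ∀ {n} (ρ : Fin 0 → Fin n) (c : Term L 0) → renT ρ c ≡ wkClosed c
  renT-closed ρ c = trans (renT≡subT c) (subT-closed (var ∘ ρ) c)

  subT-wkClosed : ∀ {n k} (σ : Fin n → Term L k) (c : Term L 0) → subT σ (wkClosed c) ≡ wkClosed c
  subT-wkClosed σ c = trans (subT-renT c) (subT-closed _ c)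

  renT-wkClosed : ∀ {n k} (ρ : Fin n → Fin k) (c : Term L 0) → renT ρ (wkClosed c) ≡ wkClosed c
  renT-wkClosed ρ c = trans (renT≡subT (wkClosed c)) (subT-wkClosed (var ∘ ρ) c)

  wkClosed-id : (c : Term L 0) → wkClosed c ≡ c
  wkClosed-id c = trans (sym (subT-closed var c)) (subT-var c)

  sub-cong : ∀ {m k} {σ σ' : Fin m → Term L k} → σ ≗ σ' → (φ : Formula L m) → sub σ φ ≡ sub σ' φ
  sub-cong e ⊥'         = refl
  sub-cong e (rel R ts) = cong (rel R) (subTs-cong e ts)
  sub-cong e (s ≐ t)    = cong₂ _≐_ (subT-cong e s) (subT-cong e t)
  sub-cong e (φ ⇒ ψ)    = cong₂ _⇒_ (sub-cong e φ) (sub-cong e ψ)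
  sub-cong e (∀' φ)     = cong ∀' (sub-cong (λ { zero → refl ; (suc i) → cong (renT suc) (e i) }) φ)

  sub-sub : ∀ {m k j} {σ : Fin k → Term L j} {τ : Fin m → Term L k} (φ : Formula L m) →
            sub σ (sub τ φ) ≡ sub (subT σ ∘ τ) φ
  sub-sub ⊥'         = refl
  sub-sub (rel R ts) = cong (rel R) (subTs-subTs ts)
  sub-sub (s ≐ t)    = cong₂ _≐_ (subT-subT s) (subT-subT t)
  sub-sub (φ ⇒ ψ)    = cong₂ _⇒_ (sub-sub φ) (sub-sub ψ)
  sub-sub {σ = σ} {τ} (∀' φ) = cong ∀' (trans (sub-sub φ) (sub-cong liftS-comp φ))
    where
      liftS-comp : subT (liftS σ) ∘ liftS τ ≗ liftS (subT σ ∘ τ)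
      liftS-comp zero    = refl
      liftS-comp (suc i) = trans (subT-renT (τ i)) (sym (renT-subT (τ i)))

  ren≡sub : ∀ {m k} {ρ : Fin m → Fin k} (φ : Formula L m) → ren ρ φ ≡ sub (var ∘ ρ) φ
  ren≡sub ⊥'         = refl
  ren≡sub (rel R ts) = cong (rel R) (renTs≡subTs ts)
  ren≡sub (s ≐ t)    = cong₂ _≐_ (renT≡subT s) (renT≡subT t)
  ren≡sub (φ ⇒ ψ)    = cong₂ _⇒_ (ren≡sub φ) (ren≡sub ψ)
  ren≡sub (∀' φ)     = cong ∀' (trans (ren≡sub φ) (sub-cong (λ { zero → refl ; (suc i) → refl }) φ))

  sub-var : ∀ {m} (φ : Formula L m) → sub var φ ≡ φ
  sub-var ⊥'         = refl
  sub-var (rel R ts) = cong (rel R) (subTs-var ts)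
  sub-var (s ≐ t)    = cong₂ _≐_ (subT-var s) (subT-var t)
  sub-var (φ ⇒ ψ)    = cong₂ _⇒_ (sub-var φ) (sub-var ψ)
  sub-var (∀' φ)     = cong ∀' (trans (sub-cong (λ { zero → refl ; (suc i) → refl }) φ) (sub-var φ))

  sub-ren : ∀ {m k j} {σ : Fin k → Term L j} {ρ : Fin m → Fin k} (φ : Formula L m) →
            sub σ (ren ρ φ) ≡ sub (σ ∘ ρ) φ
  sub-ren {σ = σ} φ = trans (cong (sub σ) (ren≡sub φ)) (sub-sub φ)

  ren-sub : ∀ {m k j} {ρ : Fin k → Fin j} {σ : Fin m → Term L k} (φ : Formula L m) →
            ren ρ (sub σ φ) ≡ sub (renT ρ ∘ σ) φ
  ren-sub {σ = σ} φ =
    trans (ren≡sub (sub σ φ)) (trans (sub-sub φ) (sub-cong (sym ∘ renT≡subT ∘ σ) φ))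

  ⟦⟧-liftS : ∀ {m k} {σ : Fin m → Term L k} (φ : Formula L (suc m)) (t : Term L k) →
             sub (liftS σ) φ ⟦ t ⟧ ≡ sub (t ∷ˢ σ) φ
  ⟦⟧-liftS {σ = σ} φ t =
    trans (sub-sub φ) (sub-cong (λ { zero → refl ; (suc i) → trans (subT-renT (σ i)) (subT-var (σ i)) }) φ)

module Derived {L : Signature} (T : Theory L) where

  private
    variable
      n m k : ℕ
      Γ : List (Formula L n)
      φ ψ χ : Formula L n

  weaken : ∀ {Δ} → Γ ⊆ Δ → Pf T Γ φ → Pf T Δ φ
  weaken s (hyp x)        = hyp (s x)
  weaken s (ax a)         = ax a
  weaken s (⇒I d)         = ⇒I (weaken (∷⁺ʳ _ s) d)
  weaken s (⇒E d e)       = ⇒E (weaken s d) (weaken s e)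
  weaken s (raa d)        = raa (weaken (∷⁺ʳ _ s) d)
  weaken s (∀I d)         = ∀I (weaken (map⁺ (ren suc) s) d)
  weaken s (∀E d t)       = ∀E (weaken s d) t
  weaken s (≐refl t)      = ≐refl t
  weaken s (≐subst φ d e) = ≐subst φ (weaken s d) (weaken s e)

  wk1 : Pf T Γ φ → Pf T (ψ ∷ Γ) φ
  wk1 = weaken (xs⊆x∷xs _ _)

  h0 : Pf T (φ ∷ Γ) φ
  h0 = hyp (here refl)

  h1 : Pf T (ψ ∷ φ ∷ Γ) φ
  h1 = hyp (there (here refl))

  efq : Pf T Γ ⊥' → Pf T Γ φ
  efq p = raa (wk1 p)

  ⊤I : Pf T Γ ⊤'
  ⊤I = ⇒I h0

  ∧I : Pf T Γ φ → Pf T Γ ψ → Pf T Γ (φ ∧' ψ)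
  ∧I p q = ⇒I (⇒E (⇒E h0 (wk1 p)) (wk1 q))

  ∧E₁ : Pf T Γ (φ ∧' ψ) → Pf T Γ φ
  ∧E₁ p = raa (⇒E (wk1 p) (⇒I (⇒I (⇒E (hyp (there (there (here refl)))) h1))))

  ∧E₂ : Pf T Γ (φ ∧' ψ) → Pf T Γ ψ
  ∧E₂ p = raa (⇒E (wk1 p) (⇒I (wk1 h0)))

  ∨I₁ : Pf T Γ φ → Pf T Γ (φ ∨' ψ)
  ∨I₁ p = ⇒I (efq (⇒E h0 (wk1 p)))

  ∨I₂ : Pf T Γ ψ → Pf T Γ (φ ∨' ψ)
  ∨I₂ p = ⇒I (wk1 p)

  ∨E : Pf T Γ (φ ∨' ψ) → Pf T (φ ∷ Γ) χ → Pf T (ψ ∷ Γ) χ → Pf T Γ χ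
  ∨E p d₁ d₂ = raa (⇒E h0 (⇒E (⇒I (weaken (∷⁺ʳ _ there) d₂))
                              (⇒E (wk1 p) (⇒I (⇒E h1 (weaken (∷⁺ʳ _ there) d₁))))))

  ∃I : (t : Term L n) {φ : Formula L (suc n)} → Pf T Γ (φ ⟦ t ⟧) → Pf T Γ (∃' φ)
  ∃I t p = ⇒I (⇒E (∀E h0 t) (wk1 p))

  ∃E : Pf T Γ (∃' φ) → Pf T (φ ∷ map (ren suc) Γ) (ren suc ψ) → Pf T Γ ψ
  ∃E p d = raa (⇒E (wk1 p) (∀I (⇒I (⇒E h1 (weaken (∷⁺ʳ _ there) d)))))

  ∀E-sub : {σ : Fin m → Term L n} {φ : Formula L (suc m)} →
           Pf T Γ (sub σ (∀' φ)) → (t : Term L n) → Pf T Γ (sub (t ∷ˢ σ) φ)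
  ∀E-sub {φ = φ} p t = subst (Pf T _) (⟦⟧-liftS φ t) (∀E p t)

  ∃I-sub : {σ : Fin m → Term L n} {φ : Formula L (suc m)} →
           (t : Term L n) → Pf T Γ (sub (t ∷ˢ σ) φ) → Pf T Γ (sub σ (∃' φ))
  ∃I-sub {φ = φ} t p = ∃I t (subst (Pf T _) (sym (⟦⟧-liftS φ t)) p)

  ax-∀ : {φ : Formula L 1} → T (∀' φ) → (t : Term L n) → Pf T Γ (sub (t ∷ˢ (λ ())) φ)
  ax-∀ {φ = φ} a t =
    subst (Pf T _) (sub-cong (λ { zero → refl }) φ) (∀E-sub (subst (Pf T _) (ren≡sub (∀' φ)) (ax a)) t)

  sub-cong⁺ : {σ σ' : Fin m → Term L n} (φ : Formula L m) → σ ≗ σ' →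
              Pf T Γ (sub σ φ) → Pf T Γ (sub σ' φ)
  sub-cong⁺ φ e = subst (Pf T _) (sub-cong e φ)

  sub-ren⁺ : {σ : Fin k → Term L n} {ρ : Fin m → Fin k} →
             Pf T Γ (sub (σ ∘ ρ) φ) → Pf T Γ (sub σ (ren ρ φ))
  sub-ren⁺ {φ = φ} = subst (Pf T _) (sym (sub-ren φ))

  sub-ren⁻ : {σ : Fin k → Term L n} {ρ : Fin m → Fin k} →
             Pf T Γ (sub σ (ren ρ φ)) → Pf T Γ (sub (σ ∘ ρ) φ)
  sub-ren⁻ {φ = φ} = subst (Pf T _) (sub-ren φ)

  ≐subst-sub : {σ : Fin m → Term L n} {s t : Term L n} (φ : Formula L (suc m)) →
               Pf T Γ (s ≐ t) → Pf T Γ (sub (s ∷ˢ σ) φ) → Pf T Γ (sub (t ∷ˢ σ) φ)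
  ≐subst-sub {σ = σ} {s} {t} φ e p =
    subst (Pf T _) (⟦⟧-liftS φ t) (≐subst (sub (liftS σ) φ) e (subst (Pf T _) (sym (⟦⟧-liftS φ s)) p))

  ≐sym : {s t : Term L n} → Pf T Γ (s ≐ t) → Pf T Γ (t ≐ s)
  ≐sym {s = s} e = ≐subst-sub {σ = s ∷ˢ var} (var zero ≐ var (suc zero)) e (≐refl s)

  ≐trans : {r s t : Term L n} → Pf T Γ (r ≐ s) → Pf T Γ (s ≐ t) → Pf T Γ (r ≐ t)
  ≐trans {r = r} e₁ e₂ = ≐subst-sub {σ = r ∷ˢ var} (var (suc zero) ≐ var zero) e₂ e₁

  ≐subst₂ : {σ : Fin m → Term L n} {a a' b b' : Term L n} (φ : Formula L (suc (suc m))) →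
            Pf T Γ (a ≐ a') → Pf T Γ (b ≐ b') →
            Pf T Γ (sub (a ∷ˢ b ∷ˢ σ) φ) → Pf T Γ (sub (a' ∷ˢ b' ∷ˢ σ) φ)
  ≐subst₂ {σ = σ} {a' = a'} {b} {b'} φ ea eb p =
    subst (Pf T _) (swapped a' b') (≐subst-sub (ren swap φ) eb
      (subst (Pf T _) (sym (swapped a' b)) (≐subst-sub φ ea p)))
    where
      swap : ∀ {j} → Fin (suc (suc j)) → Fin (suc (suc j))
      swap zero          = suc zero
      swap (suc zero)    = zero
      swap (suc (suc i)) = suc (suc i)
      swapped : ∀ x y → sub (y ∷ˢ x ∷ˢ σ) (ren swap φ) ≡ sub (x ∷ˢ y ∷ˢ σ) φ
      swapped x y = trans (sub-ren φ)
        (sub-cong (λ { zero → refl ; (suc zero) → refl ; (suc (suc i)) → refl }) φ)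

  infix 2 _⊣⊢_
  _⊣⊢_ : Formula L n → Formula L n → Set
  φ ⊣⊢ ψ = (∀ {Γ} → Pf T Γ φ → Pf T Γ ψ) × (∀ {Γ} → Pf T Γ ψ → Pf T Γ φ)

  ⊣⊢-refl : φ ⊣⊢ φ
  ⊣⊢-refl = (λ p → p) , (λ p → p)

  ⊣⊢-sym : φ ⊣⊢ ψ → ψ ⊣⊢ φ
  ⊣⊢-sym (f , g) = g , f

  ⊣⊢-trans : φ ⊣⊢ ψ → ψ ⊣⊢ χ → φ ⊣⊢ χ
  ⊣⊢-trans (f , g) (f' , g') = (λ p → f' (f p)) , (λ p → g (g' p))

  ⊣⊢-setoid : ℕ → Setoid _ _
  ⊣⊢-setoid n = record
    { Carrier       = Formula L n
    ; _≈_           = _⊣⊢_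
    ; isEquivalence = record { refl = ⊣⊢-refl ; sym = ⊣⊢-sym ; trans = ⊣⊢-trans }
    }

  module ⊣⊢-Reasoning {n : ℕ} = SetoidReasoning (⊣⊢-setoid n)

  ∨-cong : ∀ {φ φ' ψ ψ' : Formula L n} → φ ⊣⊢ φ' → ψ ⊣⊢ ψ' → (φ ∨' ψ) ⊣⊢ (φ' ∨' ψ')
  ∨-cong (f , g) (f' , g') = (λ p → ∨E p (∨I₁ (f h0)) (∨I₂ (f' h0)))
                           , (λ p → ∨E p (∨I₁ (g h0)) (∨I₂ (g' h0)))

  ∨-assoc : (φ ∨' (ψ ∨' χ)) ⊣⊢ ((φ ∨' ψ) ∨' χ)
  ∨-assoc = (λ p → ∨E p (∨I₁ (∨I₁ h0)) (∨E h0 (∨I₁ (∨I₂ h0)) (∨I₂ h0)))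
          , (λ p → ∨E p (∨E h0 (∨I₁ h0) (∨I₂ (∨I₁ h0))) (∨I₂ (∨I₂ h0)))

  ∨-identityʳ : (φ ∨' ⊥') ⊣⊢ φ
  ∨-identityʳ = (λ p → ∨E p h0 (efq h0)) , ∨I₁

  ⋁-++ : (φs ψs : List (Formula L n)) → ⋁ (φs ++ ψs) ⊣⊢ (⋁ φs ∨' ⋁ ψs)
  ⋁-++ []       ψs = ∨I₂ , (λ p → ∨E p (efq h0) h0)
  ⋁-++ (φ ∷ φs) ψs = ⊣⊢-trans (∨-cong ⊣⊢-refl (⋁-++ φs ψs)) ∨-assoc

  ⋁-map-cong : ∀ {A : Set} {f g : A → Formula L n} → (∀ a → f a ⊣⊢ g a) →
               (as : List A) → ⋁ (map f as) ⊣⊢ ⋁ (map g as)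
  ⋁-map-cong e []       = ⊣⊢-refl
  ⋁-map-cong e (a ∷ as) = ∨-cong (e a) (⋁-map-cong e as)

  ⇔I : φ ⊣⊢ ψ → Pf T Γ (φ ⇔' ψ)
  ⇔I (f , g) = ∧I (⇒I (f h0)) (⇒I (g h0))

  ⇔E : (∀ {Γ} → Pf T Γ (φ ⇔' ψ)) → φ ⊣⊢ ψ
  ⇔E p = (λ q → ⇒E (∧E₁ p) q) , (λ q → ⇒E (∧E₂ p) q)

tr-⋁-map : ∀ {L₁ L₂} (τ : Translation L₁ L₂) {n} {A : Set} (f : A → Formula L₁ n) (as : List A) →
           Translate.tr τ (⋁ (map f as)) ≡ ⋁ (map (Translate.tr τ ∘ f) as)
tr-⋁-map τ f []       = refl
tr-⋁-map τ f (a ∷ as) = cong (Translate.tr τ (f a) ∨'_) (tr-⋁-map τ f as)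

decode : Term LQT 0 → Term LT 0
decode (fn aF [])                                        = fn zeroF []
decode (fn starF (fn bF [] ∷ fn starF (p ∷ q ∷ []) ∷ [])) = fn pairF (decode p ∷ decode q ∷ [])
decode _                                                 = fn zeroF []

decode-^τ : (t : Term LT 0) → decode (t ^τ) ≡ t
decode-^τ (fn zeroF [])           = refl
decode-^τ (fn pairF (u ∷ v ∷ [])) = cong₂ (λ u v → fn pairF (u ∷ v ∷ [])) (decode-^τ u) (decode-^τ v)

^τ-injective : ∀ {s t} → s ^τ ≡ t ^τ → s ≡ t
^τ-injective {s} {t} e = trans (sym (decode-^τ s)) (trans (cong decode e) (decode-^τ t))

τ-WT : Translation LT LQT
τ-WT = record { δ = ⊤' ; funF = graph ; relF = λ { ⊑R → var zero ⊑* var (suc zero) } }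
  where
    graph : (f : FuncT) → Formula LQT (suc (arityFT f))
    graph zeroF = var zero ≐ aQ
    graph pairF = var zero ≐ bQ * (var (suc zero) * var (suc (suc zero)))

open Translate τ-WT
open Derived WQT

-- As δ = ⊤', the atom amounts to ∃z₀ z₁. φ₀(z₀) ∧ φ₁(z₁) ∧ ψ(z₀, z₁).
atom₂-intro : ∀ {m j} {Γ : List (Formula LQT j)} {σ : Fin m → Term LQT j}
              {φ₀ φ₁ : Formula LQT (suc m)} {ψ : Formula LQT (suc (suc m))} (w₀ w₁ : Term LQT j) →
              Pf WQT Γ (sub (w₀ ∷ˢ σ) φ₀) → Pf WQT Γ (sub (w₁ ∷ˢ σ) φ₁) →
              Pf WQT Γ (sub (w₀ ∷ˢ w₁ ∷ˢ σ) ψ) →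
              Pf WQT Γ (sub σ (atom (φ₀ ∷ φ₁ ∷ []) ψ))
atom₂-intro {φ₀ = φ₀} {φ₁} w₀ w₁ p₀ p₁ q =
  ∃I-sub w₁ (∃I-sub w₀ (∧I (∧I ⊤I (∧I ⊤I ⊤I))
    (∧I (∧I (sub-ren⁺ (sub-cong⁺ φ₀ (λ { zero → refl ; (suc i) → refl }) p₀))
            (∧I (sub-ren⁺ (sub-cong⁺ φ₁ (λ { zero → refl ; (suc i) → refl }) p₁)) ⊤I))
        q)))

atom₂-elim : ∀ {m j} {Γ : List (Formula LQT j)} {σ : Fin m → Term LQT j}
             {φ₀ φ₁ : Formula LQT (suc m)} {ψ : Formula LQT (suc (suc m))} {χ : Formula LQT j} →
             Pf WQT Γ (sub σ (atom (φ₀ ∷ φ₁ ∷ []) ψ)) →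
             (let σ⁺⁺ = renT suc ∘ renT suc ∘ σ in
              ∀ {Δ} → Pf WQT Δ (sub (var zero ∷ˢ σ⁺⁺) φ₀) →
                      Pf WQT Δ (sub (var (suc zero) ∷ˢ σ⁺⁺) φ₁) →
                      Pf WQT Δ (sub (var zero ∷ˢ var (suc zero) ∷ˢ σ⁺⁺) ψ) →
                      Pf WQT Δ (ren suc (ren suc χ))) →
             Pf WQT Γ χ
atom₂-elim {φ₀ = φ₀} {φ₁} {ψ} p k = ∃E p (∃E h0 (k
  (sub-cong⁺ φ₀ (λ { zero → refl ; (suc i) → refl }) (sub-ren⁻ (∧E₁ (∧E₁ (∧E₂ h0)))))
  (sub-cong⁺ φ₁ (λ { zero → refl ; (suc i) → refl }) (sub-ren⁻ (∧E₁ (∧E₂ (∧E₁ (∧E₂ h0))))))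
  (sub-cong⁺ ψ (λ { zero → refl ; (suc zero) → refl ; (suc (suc i)) → refl }) (∧E₂ (∧E₂ h0)))))

-- The graph of (x,y) as renamed inside trT: the argument witnesses are the innermost variables.
pairGraph : ∀ {n} → Formula LQT (suc (suc (suc n)))
pairGraph = var (suc (suc zero)) ≐ bQ * (var zero * var (suc zero))

trT-closed⇒≐ : ∀ {n m} (t : Term LT 0) {σ : Fin (suc n) → Term LQT m} {Γ : List (Formula LQT m)} →
               Pf WQT Γ (sub σ (trT (wkClosed t))) → Pf WQT Γ (σ zero ≐ wkClosed (t ^τ))
trT-closed⇒≐ (fn zeroF [])           p = ∧E₂ (∧E₂ p)
trT-closed⇒≐ {n} {m} (fn pairF (u ∷ v ∷ [])) {σ} p =
  atom₂-elim {ψ = pairGraph} p λ {Δ} pu pv q →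
    subst (λ c → Pf WQT Δ (renT suc (renT suc (σ zero)) ≐ c))
          (sym (trans (cong (renT suc) (renT-wkClosed suc c)) (renT-wkClosed suc c)))
          (≐subst₂ {σ = σ⁺⁺} pairGraph
                   (trT-closed⇒≐ u {(var zero ∷ˢ σ⁺⁺) ∘ skip1} (sub-ren⁻ pu))
                   (trT-closed⇒≐ v {(var (suc zero) ∷ˢ σ⁺⁺) ∘ skip1} (sub-ren⁻ pv)) q)
  where
    c : Term LQT 0
    c = fn pairF (u ∷ v ∷ []) ^τ
    σ⁺⁺ : Fin (suc n) → Term LQT (suc (suc m))
    σ⁺⁺ = renT suc ∘ renT suc ∘ σ

≐⇒trT-closed : ∀ {n m} (t : Term LT 0) {σ : Fin (suc n) → Term LQT m} {Γ : List (Formula LQT m)} →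
               Pf WQT Γ (σ zero ≐ wkClosed (t ^τ)) → Pf WQT Γ (sub σ (trT (wkClosed t)))
≐⇒trT-closed (fn zeroF [])           e = ∧I ⊤I (∧I ⊤I e)
≐⇒trT-closed (fn pairF (u ∷ v ∷ [])) e = atom₂-intro {ψ = pairGraph} (wkClosed (u ^τ)) (wkClosed (v ^τ))
  (sub-ren⁺ (≐⇒trT-closed u (≐refl (wkClosed (u ^τ)))))
  (sub-ren⁺ (≐⇒trT-closed v (≐refl (wkClosed (v ^τ))))) e

-- With ψ the interpretation of ⊑ or of ≐, the left side is tr (x₀ ⊑ t) or tr (x₀ ≐ t).
relAtom⊣⊢ : (ψ : Formula LQT 2) (t : Term LT 0) →
            atom (trT x₀ ∷ trT (wkClosed t) ∷ []) (ren (_↑ˡ 1) ψ)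
              ⊣⊢ sub (x₀ ∷ˢ wkClosed (t ^τ) ∷ˢ (λ ())) ψ
relAtom⊣⊢ ψ t = forward , backward
  where
    forward : ∀ {Γ} → Pf WQT Γ (atom (trT x₀ ∷ trT (wkClosed t) ∷ []) (ren (_↑ˡ 1) ψ)) →
              Pf WQT Γ (sub (x₀ ∷ˢ wkClosed (t ^τ) ∷ˢ (λ ())) ψ)
    forward p = atom₂-elim {σ = var} {φ₀ = trT x₀} (subst (Pf WQT _) (sym (sub-var _)) p) λ px pt q →
      subst (Pf WQT _) (sym (trans (cong (ren suc) (ren-sub ψ)) (trans (ren-sub ψ) (sub-cong weakened ψ))))
        (≐subst₂ {σ = λ ()} ψ px (trT-closed⇒≐ t pt)
          (sub-cong⁺ ψ (λ { zero → refl ; (suc zero) → refl }) (sub-ren⁻ q)))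
      where
        weakened : (renT suc ∘ renT suc ∘ (x₀ ∷ˢ wkClosed (t ^τ) ∷ˢ (λ ()))) ≗
                   (var (suc (suc zero)) ∷ˢ wkClosed (t ^τ) ∷ˢ (λ ()))
        weakened zero       = refl
        weakened (suc zero) = trans (cong (renT suc) (renT-wkClosed suc (t ^τ))) (renT-wkClosed suc (t ^τ))
        weakened (suc (suc ()))

    backward : ∀ {Γ} → Pf WQT Γ (sub (x₀ ∷ˢ wkClosed (t ^τ) ∷ˢ (λ ())) ψ) →
               Pf WQT Γ (atom (trT x₀ ∷ trT (wkClosed t) ∷ []) (ren (_↑ˡ 1) ψ))
    backward q = subst (Pf WQT _) (sub-var _)
      (atom₂-intro {σ = var} {φ₀ = trT x₀} x₀ (wkClosed (t ^τ))
        (≐refl x₀) (≐⇒trT-closed t (≐refl (wkClosed (t ^τ))))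
        (sub-ren⁺ (sub-cong⁺ ψ (λ { zero → refl ; (suc zero) → refl }) q)))

WQT3-inst : ∀ {n} {Γ : List (Formula LQT n)} (x : Term LQT n) → Pf WQT Γ ((x ⊑* aQ) ⇔' (x ≐ aQ))
WQT3-inst x = ax-∀ WQT3 x

WQT2-inst : ∀ {n} {Γ : List (Formula LQT n)} (u v : Term LT 0) (x : Term LQT n) →
            let c = bQ * (wkClosed (u ^τ) * wkClosed (v ^τ)) in
            Pf WQT Γ ((x ⊑* c) ⇔' ((x ≐ c) ∨' ((x ⊑* wkClosed (u ^τ)) ∨' (x ⊑* wkClosed (v ^τ)))))
WQT2-inst u v x =
  subst (Pf WQT _) (cong₂ unfolded (subT-wkClosed _ (u ^τ)) (subT-wkClosed _ (v ^τ))) (ax-∀ (WQT2 u v) x)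
  where
    unfolded : Term LQT _ → Term LQT _ → Formula LQT _
    unfolded s t = (x ⊑* (bQ * (s * t))) ⇔' ((x ≐ bQ * (s * t)) ∨' ((x ⊑* s) ∨' (x ⊑* t)))

⊑*-^τ⊣⊢subterms : ∀ {n} (x : Term LQT n) (t : Term LT 0) →
                 (x ⊑* wkClosed (t ^τ)) ⊣⊢ ⋁ (map (λ s → x ≐ wkClosed (s ^τ)) (subtermsT t))
⊑*-^τ⊣⊢subterms x (fn zeroF []) = ⊣⊢-trans (⇔E (WQT3-inst x)) (⊣⊢-sym ∨-identityʳ)
⊑*-^τ⊣⊢subterms x (fn pairF (u ∷ v ∷ [])) = begin
  x ⊑* wkClosed (fn pairF (u ∷ v ∷ []) ^τ)
    ≈⟨ ⇔E (WQT2-inst u v x) ⟩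
  (x ≐ wkClosed (fn pairF (u ∷ v ∷ []) ^τ)) ∨' ((x ⊑* wkClosed (u ^τ)) ∨' (x ⊑* wkClosed (v ^τ)))
    ≈⟨ ∨-cong ⊣⊢-refl (∨-cong (⊑*-^τ⊣⊢subterms x u) (⊑*-^τ⊣⊢subterms x v)) ⟩
  (x ≐ wkClosed (fn pairF (u ∷ v ∷ []) ^τ)) ∨' (⋁ (map is (subtermsT u)) ∨' ⋁ (map is (subtermsT v)))
    ≈⟨ ∨-cong ⊣⊢-refl (⋁-++ (map is (subtermsT u)) (map is (subtermsT v))) ⟨
  (x ≐ wkClosed (fn pairF (u ∷ v ∷ []) ^τ)) ∨' ⋁ (map is (subtermsT u) ++ map is (subtermsT v))
    ≡⟨ cong (((x ≐ wkClosed (fn pairF (u ∷ v ∷ []) ^τ)) ∨'_) ∘ ⋁) (map-++ is (subtermsT u) (subtermsT v)) ⟨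
  ⋁ (map is (subtermsT (fn pairF (u ∷ v ∷ [])))) ∎
  where
    open ⊣⊢-Reasoning
    is : Term LT 0 → Formula LQT _
    is s = x ≐ wkClosed (s ^τ)

WT2-tr : (t : Term LT 0) →
         WQT ⊢ tr (∀' ((x₀ ⊑ wkClosed t) ⇔' ⋁ (map (λ s → x₀ ≐ wkClosed s) (subtermsT t))))
WT2-tr t = ∀I (⇒I (⇔I (begin
  tr (x₀ ⊑ wkClosed t)
    ≈⟨ relAtom⊣⊢ (var zero ⊑* var (suc zero)) t ⟩
  x₀ ⊑* wkClosed (t ^τ)
    ≈⟨ ⊑*-^τ⊣⊢subterms x₀ t ⟩
  ⋁ (map (λ s → x₀ ≐ wkClosed (s ^τ)) (subtermsT t))
    ≈⟨ ⋁-map-cong (relAtom⊣⊢ (var zero ≐ var (suc zero))) (subtermsT t) ⟨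
  ⋁ (map (tr ∘ λ s → x₀ ≐ wkClosed s) (subtermsT t))
    ≡⟨ tr-⋁-map τ-WT (λ s → x₀ ≐ wkClosed s) (subtermsT t) ⟨
  tr (⋁ (map (λ s → x₀ ≐ wkClosed s) (subtermsT t))) ∎)))
  where open ⊣⊢-Reasoning

WT1-tr : (s t : Term LT 0) → s ≢ t → WQT ⊢ tr (¬' (s ≐ t))
WT1-tr s t s≢t =
  ⇒I (atom₂-elim {σ = var} {ψ = var zero ≐ var (suc zero)} (subst (Pf WQT _) (sym (sub-var _)) h0) λ ps pt q →
    ⇒E (subst (Pf WQT _) (cong₂ (λ a b → ¬' (a ≐ b)) (renT-closed _ (s ^τ)) (renT-closed _ (t ^τ)))
              (ax (WQT1 s t (s≢t ∘ ^τ-injective))))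
       (≐subst₂ {σ = var} (var zero ≐ var (suc zero)) (value s ps) (value t pt) q))
  where
    value : ∀ {Δ} (c : Term LT 0) {σ : Fin 1 → Term LQT 2} →
            Pf WQT Δ (sub σ (trT c)) → Pf WQT Δ (σ zero ≐ wkClosed (c ^τ))
    value c p = trT-closed⇒≐ c (subst (λ c' → Pf WQT _ (sub _ (trT c'))) (sym (wkClosed-id c)) p)

graph-functional : ∀ {n} {Γ : List (Formula LQT n)} {α β γ : Formula LQT n} {y y' c : Term LQT n} →
                   Pf WQT Γ (α ∧' β ∧' γ ∧' (y ≐ c) ∧' (y' ≐ c)) → Pf WQT Γ (y ≐ y')
graph-functional p = ≐trans (∧E₁ (∧E₂ (∧E₂ (∧E₂ p)))) (≐sym (∧E₂ (∧E₂ (∧E₂ (∧E₂ p)))))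

total : (f : FuncT) → WQT ⊢ totality f
total zeroF = ⇒I (∃I aQ (∧I ⊤I (≐refl aQ)))
total pairF = ∀I (∀I (⇒I (∃I (bQ * (var zero * var (suc zero))) (∧I ⊤I (≐refl _)))))

unique : (f : FuncT) → WQT ⊢ uniqueness f
unique zeroF = ∀I (∀I (⇒I (graph-functional h0)))
unique pairF = ∀I (∀I (∀I (∀I (⇒I (graph-functional h0)))))

axioms : (φ : Formula LT 0) → WT φ → WQT ⊢ tr φ
axioms _ (WT1 s t s≢t) = WT1-tr s t s≢t
axioms _ (WT2 t)       = WT2-tr t

mainTheorem8 : WT ≤I WQT
mainTheorem8 = record
  { τ           = τ-WT
  ; domNonempty = ∃I aQ ⊤I
  ; funTotal    = total
  ; funUnique   = unique
  ; axioms      = axioms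
  }
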